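{- Let $L\subseteq\Xi^n$ and $w\in\Xi^n$. Any set $X\subseteq[n]$ containing a witness against $w$ is itself a witness against $w$. Moreover, a set $X\subseteq[n]$ is a super-witness against $w$ if and only if it is a witness against $w$.
   Context: For $Q\subseteq[n]$, $w_Q$ is the restriction of $w$ to $Q$. For $Y\subseteq[n]$ and $\sigma\in\Xi^{|Y|}$, $w_{\sigma,Y}$ is the word obtained from $w$ by replacing its subword on $Y$ (positions in increasing order) by $\sigma$. A set $Q\subseteq[n]$ is a witness against $w$ (with respect to $L$) if every $u\in\Xi^n$ with $u_Q=w_Q$ is not in $L$. A set $X\subseteq[n]$ is a super-witness against $w$ if there exists $Y\subseteq[n]\setminus X$ such that for every $\sigma\in\Xi^{|Y|}$ there exists a set $Q\subseteq X\cup Y$ which is a witness against $w_{\sigma,Y}$. -}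

module Defs where

open import Data.Nat using (ℕ; zero; suc)
open import Data.Fin using (Fin; zero; suc)
open import Data.Bool using (Bool; true; false)
open import Data.Vec using (Vec; []; _∷_)
open import Data.Fin.Subset using (Subset; _∈_; _⊆_; _∪_; ∣_∣; ∁)
open import Data.Product using (Σ; _×_; ∃-syntax)
open import Relation.Nullary using (¬_)
open import Relation.Binary.PropositionalEquality using (_≡_)
open import Level using (Level)

Word : Set → ℕ → Set
Word Ξ n = Fin n → Ξ

AgreeOn : {Ξ : Set} {n : ℕ} → Subset n → Word Ξ n → Word Ξ n → Set
AgreeOn Q u w = ∀ i → i ∈ Q → u i ≡ w i

-- w_{σ,Y}: replace the subword of w on Y (positions in increasing order)
-- by σ ∈ Ξ^{|Y|}.
replaceOn : {Ξ : Set} {n : ℕ} (Y : Subset n) → Vec Ξ ∣ Y ∣ → Word Ξ n → Word Ξ n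
replaceOn {n = suc n} (true  ∷ Y) (x ∷ σ) w zero    = x
replaceOn {n = suc n} (true  ∷ Y) (x ∷ σ) w (suc i) = replaceOn Y σ (λ j → w (suc j)) i
replaceOn {n = suc n} (false ∷ Y) σ       w zero    = w zero
replaceOn {n = suc n} (false ∷ Y) σ       w (suc i) = replaceOn Y σ (λ j → w (suc j)) i

IsWitness : {ℓ : Level} {Ξ : Set} {n : ℕ} → (Word Ξ n → Set ℓ) → Word Ξ n → Subset n → Set ℓ
IsWitness L w Q = ∀ u → AgreeOn Q u w → ¬ L u

IsSuperWitness : {ℓ : Level} {Ξ : Set} {n : ℕ} → (Word Ξ n → Set ℓ) → Word Ξ n → Subset n → Set ℓ
IsSuperWitness {Ξ = Ξ} L w X =
  ∃[ Y ] (Y ⊆ ∁ X ×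
    ((σ : Vec Ξ ∣ Y ∣) → ∃[ Q ] (Q ⊆ (X ∪ Y) × IsWitness L (replaceOn Y σ w) Q)))

module Submission where

-- (1) Monotonicity: if Q ⊆ X and Q is a witness, so is X, since agreeing
--     with w on X implies agreeing with w on Q.
-- (2) Super-witness ⇔ witness.
--   (⇐) Take Y = ∅: replacing the empty subword changes nothing, so the
--       witness X itself serves for every σ.
--   (⇒) Given u agreeing with w on X, choose σ := u restricted to Y
--       ('extract').  Then u agrees with w_{σ,Y} on X ∪ Y, and the witness
--       Q ⊆ X ∪ Y for w_{σ,Y}, enlarged to X ∪ Y by (1), excludes u from L.
-- The only facts about 'replaceOn' needed are: on Y it reads off σ (when
-- σ = extract Y u, it reproduces u), and off Y it leaves w unchanged.

open import Defs
open import Data.Nat using (ℕ)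
open import Data.Fin using (Fin; zero; suc)
open import Data.Bool using (true; false)
open import Data.Vec using (Vec; []; _∷_; here; there)
open import Data.Fin.Subset using (Subset; _⊆_; _∈_; _∉_; ∣_∣; ⊥; _∪_)
open import Data.Fin.Subset.Properties using (_∈?_; ∉⊥; p⊆p∪q; x∈p∪q⁻)
open import Data.Product using (_×_; ∃-syntax; _,_)
open import Data.Sum using (inj₁; inj₂)
open import Function.Bundles using (_⇔_; mk⇔)
open import Level using (Level)
open import Relation.Nullary using (yes; no; contradiction)
open import Relation.Binary.PropositionalEquality using (_≡_; refl; trans; sym)

extract : {Ξ : Set} {n : ℕ} (Y : Subset n) → Word Ξ n → Vec Ξ ∣ Y ∣
extract []          u = []
extract (true  ∷ Y) u = u zero ∷ extract Y (λ j → u (suc j))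
extract (false ∷ Y) u = extract Y (λ j → u (suc j))

replaceOn-extract-∈ : {Ξ : Set} {n : ℕ} (Y : Subset n) (u w : Word Ξ n) {i : Fin n} →
  i ∈ Y → replaceOn Y (extract Y u) w i ≡ u i
replaceOn-extract-∈ (true  ∷ Y) u w here      = refl
replaceOn-extract-∈ (true  ∷ Y) u w (there p) = replaceOn-extract-∈ Y (λ j → u (suc j)) (λ j → w (suc j)) p
replaceOn-extract-∈ (false ∷ Y) u w (there p) = replaceOn-extract-∈ Y (λ j → u (suc j)) (λ j → w (suc j)) p

replaceOn-∉ : {Ξ : Set} {n : ℕ} (Y : Subset n) (σ : Vec Ξ ∣ Y ∣) (w : Word Ξ n) {i : Fin n} →
  i ∉ Y → replaceOn Y σ w i ≡ w i
replaceOn-∉ (true  ∷ Y) (x ∷ σ) w {zero}  i∉Y = contradiction here i∉Y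
replaceOn-∉ (true  ∷ Y) (x ∷ σ) w {suc i} i∉Y = replaceOn-∉ Y σ (λ j → w (suc j)) (λ p → i∉Y (there p))
replaceOn-∉ (false ∷ Y) σ       w {zero}  i∉Y = refl
replaceOn-∉ (false ∷ Y) σ       w {suc i} i∉Y = replaceOn-∉ Y σ (λ j → w (suc j)) (λ p → i∉Y (there p))

agree-replaceOn-extract : {Ξ : Set} {n : ℕ} (X Y : Subset n) (u w : Word Ξ n) →
  AgreeOn X u w → AgreeOn (X ∪ Y) u (replaceOn Y (extract Y u) w)
agree-replaceOn-extract X Y u w u≈w i i∈X∪Y with i ∈? Y | x∈p∪q⁻ X Y i∈X∪Y
... | yes i∈Y | _        = sym (replaceOn-extract-∈ Y u w i∈Y)
... | no  i∉Y | inj₁ i∈X = trans (u≈w i i∈X) (sym (replaceOn-∉ Y (extract Y u) w i∉Y))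
... | no  i∉Y | inj₂ i∈Y = contradiction i∈Y i∉Y

module _ {ℓ : Level} {Ξ : Set} {n : ℕ} (L : Word Ξ n → Set ℓ) where

  witness-mono : {w : Word Ξ n} {Q X : Subset n} → Q ⊆ X → IsWitness L w Q → IsWitness L w X
  witness-mono Q⊆X wit u u≈w = wit u (λ i i∈Q → u≈w i (Q⊆X i∈Q))

  witness-respects-agree : {w w′ : Word Ξ n} {Q : Subset n} →
    AgreeOn Q w′ w → IsWitness L w Q → IsWitness L w′ Q
  witness-respects-agree w′≈w wit u u≈w′ = wit u (λ i i∈Q → trans (u≈w′ i i∈Q) (w′≈w i i∈Q))

  -- (⇒): choose σ to be the subword of the word to be excluded.
  superWitness⇒witness : {w : Word Ξ n} (X : Subset n) → IsSuperWitness L w X → IsWitness L w X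
  superWitness⇒witness {w} X (Y , _ , witnessFor) u u≈w with witnessFor (extract Y u)
  ... | Q , Q⊆X∪Y , wit =
    witness-mono Q⊆X∪Y wit u (agree-replaceOn-extract X Y u w u≈w)

  -- (⇐): take Y = ∅, so every w_{σ,Y} coincides with w and X itself is the witness.
  witness⇒superWitness : {w : Word Ξ n} (X : Subset n) → IsWitness L w X → IsSuperWitness L w X
  witness⇒superWitness {w} X wit =
    ⊥ , (λ i∈⊥ → contradiction i∈⊥ ∉⊥) , λ σ →
      X , p⊆p∪q ⊥ , witness-respects-agree (λ i _ → replaceOn-∉ ⊥ σ w ∉⊥) wit

mainTheorem5 : {ℓ : Level} {Ξ : Set} {n : ℕ} (L : Word Ξ n → Set ℓ) (w : Word Ξ n) →
    ((X : Subset n) → (∃[ Q ] (Q ⊆ X × IsWitness L w Q)) → IsWitness L w X)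
    × ((X : Subset n) → IsSuperWitness L w X ⇔ IsWitness L w X)
mainTheorem5 L w =
  (λ X (Q , Q⊆X , wit) → witness-mono L Q⊆X wit) ,
  (λ X → mk⇔ (superWitness⇒witness L X) (witness⇒superWitness L X))
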